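{- Let $\mathcal{S}=\langle\mathcal{L},\vdash\rangle$ be a logic. Then: (i) $\mathcal{S}^{l}=\langle\mathcal{L},\vdash^{l}\rangle$ is monotonic, and if $\mathcal{S}$ is monotonic then $\vdash^{l}\,\subseteq\,\vdash$; (ii) $(\vdash^{l})^{l}=\vdash^{l}$; (iii) if $\mathcal{S}$ is a Hilbert-style logic, then $\mathcal{S}^{re}$ is monotonic and $\vdash^{re}\,\subseteq\,\vdash$; (iv) if $\mathcal{S}$ is a Hilbert-style logic, then $(\vdash^{re})^{re}=\vdash^{re}$ (i.e., the restricted rules companion of $\mathcal{S}^{re}$ is $\mathcal{S}^{re}$ itself).
   Context: A logic is a pair $\langle\mathcal{L},\vdash\rangle$ where $\mathcal{L}$ is the formula algebra of some finite signature over a set of variables $V$ and $\vdash\,\subseteq\mathcal{P}(\mathcal{L})\times\mathcal{L}$ is an arbitrary relation. It is monotonic if $\Gamma\subseteq\Sigma$ and $\Gamma\vdash\alpha$ imply $\Sigma\vdash\alpha$. $\mathrm{var}(\alpha)$ is the set of variables occurring in $\alpha$, $\mathrm{var}(\Delta)=\bigcup_{\alpha\in\Delta}\mathrm{var}(\alpha)$. The left variable inclusion companion is $\mathcal{S}^l=\langle\mathcal{L},\vdash^{l}\rangle$ where $\Gamma\vdash^{l}\alpha$ iff there is $\Delta\subseteq\Gamma$ with $\mathrm{var}(\Delta)\subseteq\mathrm{var}(\alpha)$ and $\Delta\vdash\alpha$. A Hilbert-style logic is a logic whose $\vdash$ is induced by a set of axioms $A\subseteq\mathcal{L}$ and rules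 $R_\mathcal{S}\subseteq\mathcal{P}(\mathcal{L})\times\mathcal{L}$: $\Sigma\vdash\alpha$ iff there is a finite sequence $\alpha_1,\ldots,\alpha_n=\alpha$ in which each $\alpha_i$ is an axiom, an element of $\Sigma$, or there is $(\Delta,\alpha_i)\in R_\mathcal{S}$ with $\Delta\subseteq\{\alpha_1,\ldots,\alpha_{i-1}\}$. Its restricted rules companion $\mathcal{S}^{re}=\langle\mathcal{L},\vdash^{re}\rangle$ is the Hilbert-style logic with axioms $A$ and rules $\{(\Gamma,\alpha)\in R_\mathcal{S}\mid\mathrm{var}(\Gamma)\subseteq\mathrm{var}(\alpha)\}$. -}

module Defs where

open import Level using (0ℓ)
open import Data.Nat using (ℕ)
open import Data.Fin using (Fin)
open import Data.List using (List; []; _∷_)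
open import Data.List.Membership.Propositional using (_∈_)
open import Data.Product using (Σ; _×_)
open import Data.Sum using (_⊎_)
open import Relation.Unary using (Pred; _⊆_)

-- A finite signature: n operation symbols, the i-th of arity `ar i`;
-- V is the set of variables.
module Logic (n : ℕ) (ar : Fin n → ℕ) (V : Set) where

  data Fm : Set where
    var : V → Fm
    op  : (o : Fin n) → (Fin (ar o) → Fm) → Fm

  data _occursIn_ : V → Fm → Set where
    here   : ∀ {x} → x occursIn var x
    inside : ∀ {x o args} (i : Fin (ar o)) → x occursIn args i → x occursIn op o args

  FmSet : Set₁
  FmSet = Pred Fm 0ℓ

  VarsIncl : FmSet → Fm → Set
  VarsIncl Δ α = ∀ x δ → Δ δ → x occursIn δ → x occursIn α

  Cons : Set₂
  Cons = FmSet → Fm → Set₁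

  Monotonic : Cons → Set₁
  Monotonic ⊢ = ∀ Γ Σ′ α → Γ ⊆ Σ′ → ⊢ Γ α → ⊢ Σ′ α

  _⊑_ : Cons → Cons → Set₁
  ⊢₁ ⊑ ⊢₂ = ∀ Γ α → ⊢₁ Γ α → ⊢₂ Γ α

  _≐_ : Cons → Cons → Set₁
  ⊢₁ ≐ ⊢₂ = (⊢₁ ⊑ ⊢₂) × (⊢₂ ⊑ ⊢₁)

  leftCompanion : Cons → Cons
  leftCompanion ⊢ Γ α = Σ FmSet λ Δ → (Δ ⊆ Γ) × VarsIncl Δ α × ⊢ Δ α

  Rules : Set₂
  Rules = FmSet → Fm → Set₁

  -- one step of a Hilbert-style derivation: β is justified given the
  -- earlier formulas `prev` (listed in reverse order)
  Justified : FmSet → Rules → FmSet → Fm → List Fm → Set₁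
  Justified A R Σ′ β prev =
    (Level.Lift (Level.suc 0ℓ) (A β) ⊎ Level.Lift (Level.suc 0ℓ) (Σ′ β))
    ⊎ Σ FmSet (λ Δ → R Δ β × (∀ δ → Δ δ → δ ∈ prev))

  -- a valid derivation α_1,…,α_k, stored reversed (head = last formula)
  data ValidSeq (A : FmSet) (R : Rules) (Σ′ : FmSet) : List Fm → Set₁ where
    []  : ValidSeq A R Σ′ []
    _∷_ : ∀ {β prev} → Justified A R Σ′ β prev → ValidSeq A R Σ′ prev
          → ValidSeq A R Σ′ (β ∷ prev)

  HilbertCons : FmSet → Rules → Cons
  HilbertCons A R Σ′ α = Σ (List Fm) λ prev → ValidSeq A R Σ′ (α ∷ prev)

  InducedBy : Cons → FmSet → Rules → Set₁
  InducedBy ⊢ A R = ⊢ ≐ HilbertCons A R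

  restrictRules : Rules → Rules
  restrictRules R Γ α = R Γ α × Level.Lift (Level.suc 0ℓ) (VarsIncl Γ α)

  reCompanion : FmSet → Rules → Cons
  reCompanion A R = HilbertCons A (restrictRules R)

module Submission where

open import Defs
open import Data.Nat using (ℕ)
open import Data.Fin using (Fin)
open import Data.Product using (_×_; _,_; proj₁; proj₂)
open import Data.Sum using (inj₁; inj₂)
open import Function using (id; _∘_)
open import Level using (lift)
open import Relation.Unary using (_⊆_)

module Companions (n : ℕ) (ar : Fin n → ℕ) (V : Set) where
  open Logic n ar V

  _⊆ᴿ_ : Rules → Rules → Set₁
  R ⊆ᴿ R′ = ∀ {Γ β} → R Γ β → R′ Γ β

  ValidSeq-map : ∀ {A R R′ Σ₁ Σ₂} → R ⊆ᴿ R′ → Σ₁ ⊆ Σ₂ →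
                 ∀ {αs} → ValidSeq A R Σ₁ αs → ValidSeq A R′ Σ₂ αs
  ValidSeq-map R⊆R′ Σ₁⊆Σ₂ [] = []
  ValidSeq-map R⊆R′ Σ₁⊆Σ₂ (inj₁ (inj₁ axiom) ∷ s) =
    inj₁ (inj₁ axiom) ∷ ValidSeq-map R⊆R′ Σ₁⊆Σ₂ s
  ValidSeq-map R⊆R′ Σ₁⊆Σ₂ (inj₁ (inj₂ (lift hyp)) ∷ s) =
    inj₁ (inj₂ (lift (Σ₁⊆Σ₂ hyp))) ∷ ValidSeq-map R⊆R′ Σ₁⊆Σ₂ s
  ValidSeq-map R⊆R′ Σ₁⊆Σ₂ (inj₂ (Δ , rule , Δ⊆prev) ∷ s) =
    inj₂ (Δ , R⊆R′ rule , Δ⊆prev) ∷ ValidSeq-map R⊆R′ Σ₁⊆Σ₂ s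

  HilbertCons-monotonic : ∀ A R → Monotonic (HilbertCons A R)
  HilbertCons-monotonic A R Γ Σ′ α Γ⊆Σ′ (αs , s) = αs , ValidSeq-map id Γ⊆Σ′ s

  HilbertCons-mono-rules : ∀ A {R R′} → R ⊆ᴿ R′ → HilbertCons A R ⊑ HilbertCons A R′
  HilbertCons-mono-rules A R⊆R′ Γ α (αs , s) = αs , ValidSeq-map R⊆R′ id s

  restrictRules-⊆ᴿ : ∀ R → restrictRules R ⊆ᴿ R
  restrictRules-⊆ᴿ R = proj₁

  restrictRules-idempotent : ∀ R → restrictRules (restrictRules R) ⊆ᴿ restrictRules R
                                  × restrictRules R ⊆ᴿ restrictRules (restrictRules R)
  restrictRules-idempotent R = proj₁ , λ { (rule , vars) → (rule , vars) , vars }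

  reCompanion-⊑ : ∀ ⊢ A R → InducedBy ⊢ A R → reCompanion A R ⊑ ⊢
  reCompanion-⊑ ⊢ A R (_ , hilbert⊑⊢) Γ α =
    hilbert⊑⊢ Γ α ∘ HilbertCons-mono-rules A (restrictRules-⊆ᴿ R) Γ α

  reCompanion-idempotent : ∀ A R → reCompanion A (restrictRules R) ≐ reCompanion A R
  reCompanion-idempotent A R =
    HilbertCons-mono-rules A (proj₁ (restrictRules-idempotent R)) ,
    HilbertCons-mono-rules A (proj₂ (restrictRules-idempotent R))

  leftCompanion-monotonic : ∀ ⊢ → Monotonic (leftCompanion ⊢)
  leftCompanion-monotonic ⊢ Γ Σ′ α Γ⊆Σ′ (Δ , Δ⊆Γ , vars , Δ⊢α) =
    Δ , Γ⊆Σ′ ∘ Δ⊆Γ , vars , Δ⊢α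

  leftCompanion-⊑ : ∀ ⊢ → Monotonic ⊢ → leftCompanion ⊢ ⊑ ⊢
  leftCompanion-⊑ ⊢ mono Γ α (Δ , Δ⊆Γ , _ , Δ⊢α) = mono Δ Γ α Δ⊆Γ Δ⊢α

  -- (⊢ˡ)ˡ ⊑ ⊢ˡ is the inclusion above applied to ⊢ˡ, which is monotonic even when ⊢ is not.
  leftCompanion-idempotent : ∀ ⊢ → leftCompanion (leftCompanion ⊢) ≐ leftCompanion ⊢
  leftCompanion-idempotent ⊢ =
    leftCompanion-⊑ (leftCompanion ⊢) (leftCompanion-monotonic ⊢) ,
    λ Γ α (Δ , Δ⊆Γ , vars , Δ⊢α) → Δ , Δ⊆Γ , vars , (Δ , id , vars , Δ⊢α)

mainTheorem2 : (n : ℕ) (ar : Fin n → ℕ) (V : Set) →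
    let open Logic n ar V in
    (⊢ : Cons) →
    (Monotonic (leftCompanion ⊢) × (Monotonic ⊢ → leftCompanion ⊢ ⊑ ⊢))
    × (leftCompanion (leftCompanion ⊢) ≐ leftCompanion ⊢)
    × (∀ A R → InducedBy ⊢ A R →
    Monotonic (reCompanion A R) × (reCompanion A R ⊑ ⊢))
    × (∀ A R → InducedBy ⊢ A R →
    reCompanion A (restrictRules R) ≐ reCompanion A R)
mainTheorem2 n ar V ⊢ =
    (leftCompanion-monotonic ⊢ , leftCompanion-⊑ ⊢)
  , leftCompanion-idempotent ⊢
  , (λ A R induced →
      HilbertCons-monotonic A (restrictRules R) , reCompanion-⊑ ⊢ A R induced)
  , (λ A R _ → reCompanion-idempotent A R)
  where
  open Logic n ar V
  open Companions n ar V
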